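{- Let $n\ge 3$, $\alpha\in\{2,\ldots,n\}$ and $a\in\{1,\ldots,n\}$. Then the set $S^\alpha_a=\{\pi\in Sym_n:\pi(\alpha)=a\}$ is a completely regular code of covering radius $2$ in the Star graph $S_n$.
   Context: For $n\ge 3$, the Star graph $S_n$ is the Cayley graph on $Sym_n$ with generating set $\{(1\,i): 2\le i\le n\}$ ($x,y$ adjacent iff $xy^{ -1}$ is one of these transpositions). A partition $(C_1,\ldots,C_r)$ of the vertex set is equitable if for all $i,j$ there is a number $S_{i,j}$ such that every vertex of $C_i$ has exactly $S_{i,j}$ neighbours in $C_j$. A set $C$ of vertices is a completely regular code if the partition $(C^{(0)},\ldots,C^{(\rho)})$ is equitable, where $C^{(d)}$ is the set of vertices at distance $d$ from $C$ and $\rho$ (the covering radius) is the largest $d$ with $C^{(d)}\ne\emptyset$. -}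

module Defs where

open import Data.Nat using (ℕ; zero; suc; _<_)
open import Data.Fin using (Fin) renaming (zero to fzero)
open import Data.Fin.Permutation using (Permutation′; _⟨$⟩ʳ_; _∘ₚ_; transpose; _≈_)
open import Data.Fin.Subset using (Subset; _∈_; ∣_∣)
open import Data.Product using (Σ; ∃; _×_; _,_)
open import Relation.Binary.PropositionalEquality using (_≡_; _≢_)
open import Relation.Nullary using (¬_)
open import Function.Bundles using (_⇔_)

-- Points are Fin n (point 1 of the paper is fzero, point i is the
-- element with toℕ = i - 1). We write n = suc m.
Vertex : ℕ → Set
Vertex m = Permutation′ (suc m)

-- Generators: (1 i), 2 ≤ i ≤ n, i.e. transpositions (fzero i) with i ≢ fzero.
-- The neighbour of π along generator (1 i) is the vertex x with
-- x y⁻¹ = (1 i) where y = π, i.e. x = (1 i)·π, products composed left to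
-- right (_∘ₚ_ is diagrammatic): x(k) = π((1 i)(k)).
nbr : ∀ {m} → Vertex m → Fin (suc m) → Vertex m
nbr π i = transpose fzero i ∘ₚ π

Adj : ∀ {m} → Vertex m → Vertex m → Set
Adj {m} x y = Σ (Fin (suc m)) λ i → (i ≢ fzero) × (x ≈ nbr y i)

data Within {m} (C : Vertex m → Set) : ℕ → Vertex m → Set where
  here : ∀ {d x} → C x → Within C d x
  step : ∀ {d x y} → Adj x y → Within C d y → Within C (suc d) x

AtDist : ∀ {m} → (Vertex m → Set) → ℕ → Vertex m → Set
AtDist C d x = Within C d x × (∀ e → e < d → ¬ Within C e x)

-- x has exactly s neighbours in the vertex set P (neighbours of x are
-- nbr x i for i ≢ fzero, and distinct i give distinct neighbours).
NbrCount : ∀ {m} → (Vertex m → Set) → Vertex m → ℕ → Set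
NbrCount {m} P x s =
  Σ (Subset (suc m)) λ A → (∣ A ∣ ≡ s) ×
    (∀ i → (i ∈ A) ⇔ ((i ≢ fzero) × P (nbr x i)))

EquitableDistPartition : ∀ {m} → (Vertex m → Set) → ℕ → Set
EquitableDistPartition C ρ =
  ∀ i j → i Data.Nat.≤ ρ → j Data.Nat.≤ ρ →
    ∃ λ s → ∀ x → AtDist C i x → NbrCount (AtDist C j) x s

CoveringRadius : ∀ {m} → (Vertex m → Set) → ℕ → Set
CoveringRadius C ρ = (∃ λ x → AtDist C ρ x) × (∀ x → Within C ρ x)

CompletelyRegularWithRadius : ∀ {m} → (Vertex m → Set) → ℕ → Set
CompletelyRegularWithRadius C ρ = CoveringRadius C ρ × EquitableDistPartition C ρ

Sαa : ∀ {m} → Fin (suc m) → Fin (suc m) → Vertex m → Set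
Sαa α a π = π ⟨$⟩ʳ α ≡ a

-- A vertex x lies at distance 0, 1 or 2 from S^α_a according as the
-- position x⁻¹(a) of the letter a is α, 1, or neither; moving along the
-- generator (1 k) moves that position by the transposition (1 k) of points.
-- Hence every vertex of layer i has one distinguished neighbour, in layer
-- i − 1 (or layer 1 when i = 0), while its other n − 2 neighbours all lie in
-- one common layer, which makes the distance partition equitable.
module Submission where

open import Defs
open import Data.Nat using (ℕ; zero; suc; _≤_; _∸_; z≤n; s≤s)
open import Data.Nat.Properties using (≤-refl; ≤-trans; m≤n⇒m≤1+n; ≤∧≮⇒≡; <⇒≱)
import Data.Nat.Properties as ℕ
open import Data.Fin using (Fin; _≟_) renaming (zero to fzero; suc to fsuc)
open import Data.Fin.Permutation
  using (Permutation′; _⟨$⟩ʳ_; _⟨$⟩ˡ_; inverseˡ; inverseʳ; transpose; _≈_)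
import Data.Fin.Permutation.Components as PC
open import Data.Fin.Subset using (Subset; _∈_; ∣_∣; ⊥; ⁅_⁆; ∁; outside)
open import Data.Fin.Subset.Properties
  using (∉⊥; ∣⊥∣≡0; ∣⁅x⁆∣≡1; x∈⁅y⁆⇔x≡y; x∈∁p⇒x∉p; x∉p⇒x∈∁p; ∣∁p∣≡n∸∣p∣; drop-there)
open import Data.Product using (Σ; ∃; _×_; _,_)
open import Data.Product.Function.NonDependent.Propositional using (_×-⇔_)
open import Data.Sum using (_⊎_; inj₁; inj₂; [_,_])
open import Data.Vec.Base using (_∷_; there)
open import Function using (_∘_)
open import Function.Bundles using (_⇔_; mk⇔; Equivalence)
open import Function.Construct.Composition using (_⇔-∘_)
open import Function.Construct.Identity using (⇔-id)
open import Function.Construct.Symmetry using (⇔-sym)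
open import Relation.Binary.PropositionalEquality
  using (_≡_; _≢_; refl; sym; trans; cong; subst)
open import Relation.Nullary using (¬_; yes; no; contradiction)
open import Relation.Nullary.Decidable using (dec-true; dec-false)

private
  variable
    n : ℕ

transpose-i≡j : (i j : Fin n) → PC.transpose i j i ≡ j
transpose-i≡j i j rewrite dec-true (i ≟ i) refl = refl

transpose-j≡i : (i j : Fin n) → PC.transpose i j j ≡ i
transpose-j≡i i j with j ≟ i
... | yes j≡i = j≡i
... | no j≢i rewrite dec-true (j ≟ j) refl = refl

transpose-k≡k : {i j k : Fin n} → k ≢ i → k ≢ j → PC.transpose i j k ≡ k
transpose-k≡k {i = i} {j} {k} k≢i k≢j
  rewrite dec-false (k ≟ i) k≢i | dec-false (k ≟ j) k≢j = refl

transpose-involutive : (i j k : Fin n) → PC.transpose i j (PC.transpose i j k) ≡ k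
transpose-involutive i j k with k ≟ i
... | yes refl = transpose-j≡i i j
... | no k≢i with k ≟ j
...   | yes refl = transpose-i≡j i j
...   | no k≢j = transpose-k≡k k≢i k≢j

⟨$⟩ʳ≡⇒⟨$⟩ˡ≡ : (π : Permutation′ n) {i j : Fin n} → π ⟨$⟩ʳ i ≡ j → π ⟨$⟩ˡ j ≡ i
⟨$⟩ʳ≡⇒⟨$⟩ˡ≡ π refl = inverseˡ π

⟨$⟩ˡ≡⇒⟨$⟩ʳ≡ : (π : Permutation′ n) {i j : Fin n} → π ⟨$⟩ˡ j ≡ i → π ⟨$⟩ʳ i ≡ j
⟨$⟩ˡ≡⇒⟨$⟩ʳ≡ π refl = inverseʳ π

⟨$⟩ˡ-cong : {π ρ : Permutation′ n} → π ≈ ρ → ∀ j → π ⟨$⟩ˡ j ≡ ρ ⟨$⟩ˡ j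
⟨$⟩ˡ-cong {π = π} {ρ} π≈ρ j =
  sym (⟨$⟩ʳ≡⇒⟨$⟩ˡ≡ ρ (trans (sym (π≈ρ (π ⟨$⟩ˡ j))) (inverseʳ π)))

third-point : (α : Fin (suc (suc (suc n)))) → ∃ λ p → p ≢ fzero × p ≢ α
third-point α with α ≟ fsuc fzero
... | yes refl = fsuc (fsuc fzero) , (λ ()) , (λ ())
... | no α≢1 = fsuc fzero , (λ ()) , α≢1 ∘ sym

Counts : (Fin n → Set) → ℕ → Set
Counts {n} P s = Σ (Subset n) λ A → ∣ A ∣ ≡ s × (∀ i → (i ∈ A) ⇔ P i)

counts-cong : {P Q : Fin n → Set} {s : ℕ} →
  (∀ i → P i ⇔ Q i) → Counts P s → Counts Q s
counts-cong P⇔Q (A , ∣A∣≡s , A⇔P) = A , ∣A∣≡s , λ i → P⇔Q i ⇔-∘ A⇔P i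

counts-∅ : {P : Fin n → Set} → (∀ i → ¬ P i) → Counts P 0
counts-∅ {n} ¬P = ⊥ , ∣⊥∣≡0 n , λ i →
  mk⇔ (λ i∈⊥ → contradiction i∈⊥ ∉⊥) (λ p → contradiction p (¬P i))

counts-⁅⁆ : {P : Fin n → Set} (j : Fin n) → (∀ i → P i ⇔ i ≡ j) → Counts P 1
counts-⁅⁆ j P⇔≡j = ⁅ j ⁆ , ∣⁅x⁆∣≡1 j , λ i → ⇔-sym (P⇔≡j i) ⇔-∘ x∈⁅y⁆⇔x≡y

counts-≢fzero-≢ : ∀ {m} {P : Fin (suc m) → Set} (j : Fin (suc m)) → j ≢ fzero →
  (∀ i → P i ⇔ (i ≢ fzero × i ≢ j)) → Counts P (m ∸ 1)
counts-≢fzero-≢ fzero j≢0 = contradiction refl j≢0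
counts-≢fzero-≢ {m} (fsuc j) _ P⇔ = counts-cong (λ i → ⇔-sym (P⇔ i))
  (outside ∷ ∁ ⁅ j ⁆ , trans (∣∁p∣≡n∸∣p∣ ⁅ j ⁆) (cong (m ∸_) (∣⁅x⁆∣≡1 j)) , membership)
  where
  membership : ∀ i → (i ∈ outside ∷ ∁ ⁅ j ⁆) ⇔ (i ≢ fzero × i ≢ fsuc j)
  membership fzero = mk⇔ (λ ()) (λ (0≢0 , _) → contradiction refl 0≢0)
  membership (fsuc i) = mk⇔
    (λ i∈ → (λ ()) , λ { refl → x∈∁p⇒x∉p (drop-there i∈) (Equivalence.from x∈⁅y⁆⇔x≡y refl) })
    (λ (_ , i≢j) → there (x∉p⇒x∈∁p (i≢j ∘ cong fsuc ∘ Equivalence.to x∈⁅y⁆⇔x≡y)))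

record Split {m} (L : Fin (suc m) → ℕ → Set) (u v : ℕ) : Set where
  field
    centre        : Fin (suc m)
    centre≢fzero  : centre ≢ fzero
    centre-value  : L centre u
    others-value  : ∀ k → k ≢ fzero → k ≢ centre → L k v

splitCount : ℕ → ℕ → ℕ → ℕ → ℕ
splitCount m u v j with j ℕ.≟ u | j ℕ.≟ v
... | yes _ | _     = 1
... | no _  | yes _ = m ∸ 1
... | no _  | no _  = 0

module _ {m} {L : Fin (suc m) → ℕ → Set} {u v : ℕ} (split : Split L u v) (u≢v : u ≢ v)
         (L-functional : ∀ {k d e} → L k d → L k e → d ≡ e) where
  open Split split

  split-values : ∀ {k e} → k ≢ fzero → L k e → e ≡ u ⊎ e ≡ v
  split-values {k} k≢0 ℓ with k ≟ centre
  ... | yes refl = inj₁ (L-functional ℓ centre-value)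
  ... | no k≢c = inj₂ (L-functional ℓ (others-value k k≢0 k≢c))

  centre-unique : ∀ {k} → k ≢ fzero → L k u → k ≡ centre
  centre-unique {k} k≢0 ℓ with k ≟ centre
  ... | yes k≡c = k≡c
  ... | no k≢c = contradiction (L-functional ℓ (others-value k k≢0 k≢c)) u≢v

  NonzeroIn : ℕ → Fin (suc m) → Set
  NonzeroIn j k = k ≢ fzero × L k j

  split-counts : ∀ j → Counts (NonzeroIn j) (splitCount m u v j)
  split-counts j with j ℕ.≟ u | j ℕ.≟ v
  ... | yes refl | _ = counts-⁅⁆ {P = NonzeroIn j} centre λ k → mk⇔
    (λ (k≢0 , ℓ) → centre-unique k≢0 ℓ)
    (λ { refl → centre≢fzero , centre-value })
  ... | no _ | yes refl = counts-≢fzero-≢ {P = NonzeroIn j} centre centre≢fzero λ k → mk⇔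
    (λ (k≢0 , ℓ) → k≢0 , λ { refl → u≢v (L-functional centre-value ℓ) })
    (λ (k≢0 , k≢c) → k≢0 , others-value k k≢0 k≢c)
  ... | no j≢u | no j≢v = counts-∅ {P = NonzeroIn j} λ k (k≢0 , ℓ) →
    [ j≢u , j≢v ] (split-values k≢0 ℓ)

Within-mono : ∀ {m} {C : Vertex m → Set} {d e x} → d ≤ e → Within C d x → Within C e x
Within-mono _ (here x∈C) = here x∈C
Within-mono (s≤s d≤e) (step adj w) = step adj (Within-mono d≤e w)

adj-nbr : ∀ {m} (x : Vertex m) {k} → k ≢ fzero → Adj x (nbr x k)
adj-nbr x {k} k≢0 = k , k≢0 , λ i → cong (x ⟨$⟩ʳ_) (sym (transpose-involutive fzero k i))

module Layers {m} (α a : Fin (suc m)) (α≢0 : α ≢ fzero) where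

  C : Vertex m → Set
  C = Sαa α a

  position : Vertex m → Fin (suc m)
  position x = x ⟨$⟩ˡ a

  data Layer (p : Fin (suc m)) : ℕ → Set where
    at-α      : p ≡ α → Layer p 0
    at-0      : p ≡ fzero → Layer p 1
    elsewhere : p ≢ α → p ≢ fzero → Layer p 2

  layer : ∀ p → ∃ (Layer p)
  layer p with p ≟ α | p ≟ fzero
  ... | yes p≡α | _       = 0 , at-α p≡α
  ... | no _    | yes p≡0 = 1 , at-0 p≡0
  ... | no p≢α  | no p≢0  = 2 , elsewhere p≢α p≢0

  layer-functional : ∀ {p d e} → Layer p d → Layer p e → d ≡ e
  layer-functional (at-α _)          (at-α _)          = refl
  layer-functional (at-α refl)       (at-0 α≡0)        = contradiction α≡0 α≢0
  layer-functional (at-α p≡α)        (elsewhere p≢α _) = contradiction p≡α p≢α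
  layer-functional (at-0 refl)       (at-α 0≡α)        = contradiction (sym 0≡α) α≢0
  layer-functional (at-0 _)          (at-0 _)          = refl
  layer-functional (at-0 p≡0)        (elsewhere _ p≢0) = contradiction p≡0 p≢0
  layer-functional (elsewhere p≢α _) (at-α p≡α)        = contradiction p≡α p≢α
  layer-functional (elsewhere _ p≢0) (at-0 p≡0)        = contradiction p≡0 p≢0
  layer-functional (elsewhere _ _)   (elsewhere _ _)   = refl

  layer≤2 : ∀ {p d} → Layer p d → d ≤ 2
  layer≤2 (at-α _)        = z≤n
  layer≤2 (at-0 _)        = s≤s z≤n
  layer≤2 (elsewhere _ _) = ≤-refl

  centreLayer otherLayer : ℕ → ℕ
  centreLayer zero    = 1
  centreLayer (suc d) = d
  otherLayer zero    = 0
  otherLayer (suc _) = 2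

  centreLayer≢otherLayer : ∀ {p d} → Layer p d → centreLayer d ≢ otherLayer d
  centreLayer≢otherLayer (at-α _)        ()
  centreLayer≢otherLayer (at-0 _)        ()
  centreLayer≢otherLayer (elsewhere _ _) ()

  -- position (nbr x k) reduces to PC.transpose k fzero (position x).
  neighbour-split : ∀ {p d} → Layer p d →
    Split (λ k → Layer (PC.transpose k fzero p)) (centreLayer d) (otherLayer d)
  neighbour-split (at-α refl) = record
    { centre = α ; centre≢fzero = α≢0
    ; centre-value = at-0 (transpose-i≡j α fzero)
    ; others-value = λ k _ k≢α → at-α (transpose-k≡k (k≢α ∘ sym) α≢0) }
  neighbour-split (at-0 refl) = record
    { centre = α ; centre≢fzero = α≢0
    ; centre-value = at-α (transpose-j≡i α fzero)
    ; others-value = λ k k≢0 k≢α →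
        subst (λ q → Layer q 2) (sym (transpose-j≡i k fzero)) (elsewhere k≢α k≢0) }
  neighbour-split {p} (elsewhere p≢α p≢0) = record
    { centre = p ; centre≢fzero = p≢0
    ; centre-value = at-0 (transpose-i≡j p fzero)
    ; others-value = λ k _ k≢p →
        subst (λ q → Layer q 2) (sym (transpose-k≡k (k≢p ∘ sym) p≢0)) (elsewhere p≢α p≢0) }

  neighbour-layer≤ : ∀ {p d e k} → Layer p d → k ≢ fzero →
    Layer (PC.transpose k fzero p) e → e ≤ suc d
  neighbour-layer≤ ℓ@(at-α _) k≢0 ℓ′
    with split-values (neighbour-split ℓ) (centreLayer≢otherLayer ℓ) layer-functional k≢0 ℓ′
  ... | inj₁ refl = ≤-refl
  ... | inj₂ refl = z≤n
  neighbour-layer≤ (at-0 _)        _ ℓ′ = layer≤2 ℓ′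
  neighbour-layer≤ (elsewhere _ _) _ ℓ′ = m≤n⇒m≤1+n (layer≤2 ℓ′)

  ∈C⇔position≡α : ∀ x → C x ⇔ (position x ≡ α)
  ∈C⇔position≡α x = mk⇔ (⟨$⟩ʳ≡⇒⟨$⟩ˡ≡ x) (⟨$⟩ˡ≡⇒⟨$⟩ʳ≡ x)

  within⇒layer≤ : ∀ {d e x} → Within C d x → Layer (position x) e → e ≤ d
  within⇒layer≤ {x = x} (here x∈C) ℓ
    with layer-functional ℓ (at-α (Equivalence.to (∈C⇔position≡α x) x∈C))
  ... | refl = z≤n
  within⇒layer≤ {x = x} (step {y = y} (k , k≢0 , x≈nbr) w) ℓ
    with layer (position y)
  ... | e′ , ℓy = ≤-trans
    (neighbour-layer≤ ℓy k≢0 (subst (λ q → Layer q _) position-x≡ ℓ))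
    (s≤s (within⇒layer≤ w ℓy))
    where
    position-x≡ : position x ≡ PC.transpose k fzero (position y)
    position-x≡ = ⟨$⟩ˡ-cong {π = x} {nbr y k} x≈nbr a

  layer⇒within : ∀ d x → Layer (position x) d → Within C d x
  layer⇒within zero    x (at-α p≡α) = here (Equivalence.from (∈C⇔position≡α x) p≡α)
  layer⇒within (suc d) x ℓ =
    step (adj-nbr x centre≢fzero) (layer⇒within d (nbr x centre) centre-value)
    where open Split (neighbour-split ℓ)

  atDist⇔layer : ∀ {d} x → AtDist C d x ⇔ Layer (position x) d
  atDist⇔layer {d} x = mk⇔ sound complete
    where
    sound : AtDist C d x → Layer (position x) d
    sound (w , no-closer) with layer (position x)
    ... | e , ℓ = subst (Layer _)
      (≤∧≮⇒≡ (within⇒layer≤ w ℓ) (λ e<d → no-closer e e<d (layer⇒within e x ℓ))) ℓ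
    complete : Layer (position x) d → AtDist C d x
    complete ℓ = layer⇒within d x ℓ , λ e e<d w → <⇒≱ e<d (within⇒layer≤ w ℓ)

  coveringRadius : (∃ λ p → p ≢ fzero × p ≢ α) → CoveringRadius C 2
  coveringRadius (p , p≢0 , p≢α) = far , near
    where
    far : ∃ λ x → AtDist C 2 x
    far = transpose p a , Equivalence.from (atDist⇔layer (transpose p a))
      (subst (λ q → Layer q 2) (sym (transpose-i≡j a p)) (elsewhere p≢α p≢0))
    near : ∀ x → Within C 2 x
    near x with layer (position x)
    ... | e , ℓ = Within-mono (layer≤2 ℓ) (layer⇒within e x ℓ)

  equitable : EquitableDistPartition C 2
  equitable i j _ _ = splitCount m (centreLayer i) (otherLayer i) j , λ x x∈Cⁱ →
    let ℓ = Equivalence.to (atDist⇔layer x) x∈Cⁱ in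
    counts-cong (λ k → ⇔-id _ ×-⇔ ⇔-sym (atDist⇔layer (nbr x k)))
      (split-counts (neighbour-split ℓ) (centreLayer≢otherLayer ℓ) layer-functional j)

lemma12 : (m : ℕ) → 3 ≤ suc m → (α a : Fin (suc m)) → α ≢ fzero →
    CompletelyRegularWithRadius (Sαa {m} α a) 2
lemma12 0 (s≤s ())
lemma12 1 (s≤s (s≤s ()))
lemma12 (suc (suc m)) _ α a α≢0 = coveringRadius (third-point α) , equitable
  where open Layers α a α≢0
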